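{- Let $k\geq 4$ be even and let $G$ be a metric graph on $n$ vertices with $k$ dividing $n$. Let $\mathcal{P}_k$ be any $k$-path packing of $G$. For each path $P_i=v_{i1}v_{i2}\cdots v_{ik}\in\mathcal{P}_k$ and each $j\in\{1,\dots,k-1\}$ let $C_{ij}$ be the $k$-cycle $v_{i1}v_{i2}\cdots v_{ij}v_{ik}v_{i(k-1)}\cdots v_{i(j+1)}v_{i1}$, let $C_{ij_i}$ be one of maximum weight among $C_{i1},\dots,C_{i(k-1)}$, and let $\mathcal{C}_k=\{C_{ij_i}\}_{i}$. Then $$w(\mathcal{C}_k)\geq\frac{k-2}{k-1}w(\mathcal{P}_k)+\frac{2}{k-1}\widetilde{w}(\mathcal{P}_k).$$
   Context: A metric graph is an undirected complete graph with a non-negative edge weight function $w$ satisfying the triangle inequality; the weight of a path, cycle, or collection thereof is the total weight of its edges. A $k$-path (resp. $k$-cycle) is a simple path (resp. cycle) on exactly $k$ distinct vertices; a $k$-path packing is a set of $n/k$ vertex-disjoint $k$-paths covering all vertices. For a $k$-path $P=v_1v_2\cdots v_k$ with $k$ even, $\widetilde{w}(P)=\sum_{j=1}^{k/2}w(v_{2j-1},v_{2j})$, and for a set of such paths $\widetilde{w}$ is the sum over its paths.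
   Formalization: The edge weights of the metric graph G take values in the rationals. -}

module Defs where

open import Data.Nat as ℕ using (ℕ; zero; suc)
open import Data.Fin using (Fin)
open import Data.List using (List; []; _∷_; take; drop; reverse; _++_; map; concat; length; allFin)
open import Data.List.Relation.Unary.All using (All)
open import Data.List.Relation.Binary.Permutation.Propositional using (_↭_)
open import Data.Integer using (+_)
open import Data.Rational using (ℚ; 0ℚ; _+_; _*_; _≤_; _/_)
open import Data.Product using (_×_)
open import Relation.Binary.PropositionalEquality using (_≡_; _≢_)

ℕ→ℚ : ℕ → ℚ
ℕ→ℚ m = (+ m) / 1

-- Metric on the vertex set Fin n (edge weights of the complete graph).
-- Only edges between distinct vertices matter; conditions are imposed on them.
record IsMetric {n : ℕ} (w : Fin n → Fin n → ℚ) : Set where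
  field
    nonneg   : ∀ x y → x ≢ y → 0ℚ ≤ w x y
    symmetric : ∀ x y → x ≢ y → w x y ≡ w y x
    triangle : ∀ x y z → x ≢ y → y ≢ z → x ≢ z → w x z ≤ w x y + w y z

module _ {n : ℕ} (w : Fin n → Fin n → ℚ) where

  sumℚ : List ℚ → ℚ
  sumℚ [] = 0ℚ
  sumℚ (q ∷ qs) = q + sumℚ qs

  pathW : List (Fin n) → ℚ
  pathW [] = 0ℚ
  pathW (x ∷ []) = 0ℚ
  pathW (x ∷ y ∷ r) = w x y + pathW (y ∷ r)

  lastOf : Fin n → List (Fin n) → Fin n
  lastOf x [] = x
  lastOf x (y ∷ r) = lastOf y r

  cycleW : List (Fin n) → ℚ
  cycleW [] = 0ℚ
  cycleW (x ∷ r) = pathW (x ∷ r) + w (lastOf x r) x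

  tildeW : List (Fin n) → ℚ
  tildeW (x ∷ y ∷ r) = w x y + tildeW r
  tildeW _ = 0ℚ

  pathsW : List (List (Fin n)) → ℚ
  pathsW ps = sumℚ (map pathW ps)

  tildeWs : List (List (Fin n)) → ℚ
  tildeWs ps = sumℚ (map tildeW ps)

cycleOf : {n : ℕ} → List (Fin n) → ℕ → List (Fin n)
cycleOf p j = take j p ++ reverse (drop j p)

-- a k-path packing: a list of simple k-paths, vertex-disjoint and covering
-- all vertices (the concatenation of the paths is a permutation of all vertices)
IsKPathPacking : {n : ℕ} → ℕ → List (List (Fin n)) → Set
IsKPathPacking {n} k P = All (λ p → length p ≡ k) P × (concat P ↭ allFin n)

-- For a path P = v₁ ⋯ v_k, the cycle C_j arises from P by deleting the edge v_j v_{j+1} and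
-- adding the edges v_j v_k and v_{j+1} v₁. Summing over j = 1, …, k − 1 gives
--   Σ_j w(C_j) = (k − 2) w(P) + F + G   with the spoke sums
--   F = Σ_{i<k} w(v_i, v_k) = initSpokes   and   G = Σ_{i>1} w(v_i, v₁) = spokes.
-- Pairing v_{2j−1} with v_{2j}, the triangle inequality through v_k bounds F below by w̃(P),
-- and the triangle inequality through v₁ does the same for G. As the heaviest cycle is at
-- least the average of the k − 1 cycles, (k − 1) w(C_J) ≥ (k − 2) w(P) + 2 w̃(P); summing
-- over the paths of the packing gives the theorem.
module Submission where

open import Defs
open import Data.Nat using (ℕ; _∸_) renaming (_≤_ to _≤ℕ_)
open import Data.Nat.Divisibility using (_∣_)
open import Data.Fin using (Fin)
open import Data.List using (List; map)
open import Data.List.Relation.Unary.All using (All)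
open import Data.Product using (_×_)
open import Data.Rational using (ℚ; _+_; _*_; _≤_)

open import Algebra.Bundles using (CommutativeMonoid)
open import Data.Empty using (⊥-elim)
open import Data.Nat using (zero; suc; z≤n; s≤s) renaming (_<_ to _<ℕ_)
open import Data.Nat.Properties using (<-irrefl; m<n⇒0<n∸m)
open import Data.Nat.Coprimality using (1-coprimeTo)
import Data.Nat.Coprimality as Coprime
open import Data.Nat.Divisibility using (∣m+n∣m⇒∣n; ∣-refl; ∣1⇒≡1)
import Data.Integer as ℤ
import Data.Integer.Solver as ℤ-Solver
open import Data.Rational using (mkℚ; 0ℚ; 1ℚ)
open import Data.Rational.Properties
  using ( ≤-refl; ≤-reflexive; ≤-trans; +-mono-≤; +-monoʳ-≤; +-assoc; +-comm; +-identityˡ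
        ; +-identityʳ; *-identityˡ; *-zeroˡ; *-zeroʳ; *-distribˡ-+; *-distribʳ-+
        ; +-0-group; +-0-commutativeMonoid; normalize-coprime; toℚᵘ-injective; toℚᵘ-homo-+
        ; module ≤-Reasoning )
import Data.Rational.Unnormalised as ℚᵘ
import Data.Rational.Unnormalised.Properties as ℚᵘ
open import Data.Rational.Solver using (module +-*-Solver)
open import Algebra.Properties.Group +-0-group using (∙-cancelʳ)
open import Algebra.Properties.CommutativeSemigroup
  (CommutativeMonoid.commutativeSemigroup +-0-commutativeMonoid) using (interchange)
open import Data.List using ([]; _∷_; take; drop; reverse; reverseAcc; _++_; length; concat)
open import Data.List.Properties using (take++drop≡id; length-drop)
open import Data.List.Membership.Propositional using (_∈_)
open import Data.List.Relation.Unary.Any using (here; there)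
open import Data.List.Relation.Unary.All using ([]; _∷_)
import Data.List.Relation.Unary.All as All
import Data.List.Relation.Unary.All.Properties as All
open import Data.List.Relation.Unary.AllPairs using ([]; _∷_)
open import Data.List.Relation.Unary.AllPairs.Properties using (drop⁺)
open import Data.List.Relation.Unary.Unique.Propositional using (Unique)
open import Data.List.Relation.Unary.Unique.Propositional.Properties using (allFin⁺)
open import Data.List.Relation.Binary.Permutation.Propositional using (↭-sym; ↭⇒↭ₛ)
import Data.List.Relation.Binary.Permutation.Setoid.Properties as Permutation
open import Data.Product using (∃; _,_; proj₁; proj₂)
open import Function using (flip; case_of_)
open import Relation.Binary.PropositionalEquality
open import Relation.Nullary using (¬_)

ℕ→ℚ-suc : ∀ m → ℕ→ℚ (suc m) ≡ 1ℚ + ℕ→ℚ m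
ℕ→ℚ-suc m
  rewrite normalize-coprime {m} {0} (Coprime.sym (1-coprimeTo m))
        | normalize-coprime {suc m} {0} (Coprime.sym (1-coprimeTo (suc m)))
  = toℚᵘ-injective (ℚᵘ.≃-sym (ℚᵘ.≃-trans (toℚᵘ-homo-+ 1ℚ (mkℚ (ℤ.+ m) 0 (Coprime.sym (1-coprimeTo m)))) (ℚᵘ.*≡* cross-multiplied)))
  where
  open ℤ-Solver.+-*-Solver
  cross-multiplied : (ℤ.+ 1 ℤ.* ℤ.+ 1 ℤ.+ ℤ.+ m ℤ.* ℤ.+ 1) ℤ.* ℤ.+ 1
                   ≡ (ℤ.+ 1 ℤ.+ ℤ.+ m) ℤ.* (ℤ.+ 1 ℤ.* ℤ.+ 1)
  cross-multiplied = solve 1 (λ x → (con (ℤ.+ 1) :* con (ℤ.+ 1) :+ x :* con (ℤ.+ 1)) :* con (ℤ.+ 1)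
                                  := (con (ℤ.+ 1) :+ x) :* (con (ℤ.+ 1) :* con (ℤ.+ 1)))
                           refl (ℤ.+ m)

2*q≡q+q : ∀ q → ℕ→ℚ 2 * q ≡ q + q
2*q≡q+q q = trans (*-distribʳ-+ q 1ℚ 1ℚ) (cong₂ _+_ (*-identityˡ q) (*-identityˡ q))

2∤1 : ¬ 2 ∣ 1
2∤1 2∣1 = case ∣1⇒≡1 2∣1 of λ ()

2∣2+n⇒2∣n : ∀ {n} → 2 ∣ suc (suc n) → 2 ∣ n
2∣2+n⇒2∣n {n} 2∣2+n = ∣m+n∣m⇒∣n {m = 2} {n = n} 2∣2+n ∣-refl

Σ< : ℕ → (ℕ → ℚ) → ℚ
Σ< zero    f = 0ℚ
Σ< (suc m) f = f 0 + Σ< m (λ i → f (suc i))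

Σ<-cong : ∀ m {f g} → (∀ i → i <ℕ m → f i ≡ g i) → Σ< m f ≡ Σ< m g
Σ<-cong zero    f≡g = refl
Σ<-cong (suc m) f≡g = cong₂ _+_ (f≡g 0 (s≤s z≤n)) (Σ<-cong m (λ i i<m → f≡g (suc i) (s≤s i<m)))

Σ<-mono : ∀ m {f g} → (∀ i → i <ℕ m → f i ≤ g i) → Σ< m f ≤ Σ< m g
Σ<-mono zero    f≤g = ≤-refl
Σ<-mono (suc m) f≤g = +-mono-≤ (f≤g 0 (s≤s z≤n)) (Σ<-mono m (λ i i<m → f≤g (suc i) (s≤s i<m)))

Σ<-+ : ∀ m f g → Σ< m (λ i → f i + g i) ≡ Σ< m f + Σ< m g
Σ<-+ zero    f g = refl
Σ<-+ (suc m) f g = trans (cong (f 0 + g 0 +_) (Σ<-+ m (λ i → f (suc i)) (λ i → g (suc i))))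
                         (interchange (f 0) (g 0) _ _)

Σ<-const : ∀ m c → Σ< m (λ _ → c) ≡ ℕ→ℚ m * c
Σ<-const zero    c = sym (*-zeroˡ c)
Σ<-const (suc m) c = begin
  c + Σ< m (λ _ → c)         ≡⟨ cong₂ _+_ (sym (*-identityˡ c)) (Σ<-const m c) ⟩
  1ℚ * c + ℕ→ℚ m * c         ≡⟨ sym (*-distribʳ-+ c 1ℚ (ℕ→ℚ m)) ⟩
  (1ℚ + ℕ→ℚ m) * c           ≡⟨ cong (_* c) (sym (ℕ→ℚ-suc m)) ⟩
  ℕ→ℚ (suc m) * c            ∎
  where open ≡-Reasoning

headOr : ∀ {A : Set} → A → List A → A
headOr d []      = d
headOr d (x ∷ _) = x

Unique-++⁻ : ∀ {A : Set} (xs : List A) {ys} → Unique (xs ++ ys) → Unique xs × Unique ys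
Unique-++⁻ []       u          = [] , u
Unique-++⁻ (x ∷ xs) (x∉ ∷ u) with Unique-++⁻ xs u
... | xs-unique , ys-unique = (All.++⁻ˡ xs x∉ ∷ xs-unique) , ys-unique

Unique-concat⁻ : ∀ {A : Set} (xss : List (List A)) → Unique (concat xss) → All Unique xss
Unique-concat⁻ []         _ = []
Unique-concat⁻ (xs ∷ xss) u with Unique-++⁻ xs u
... | xs-unique , rest-unique = xs-unique ∷ Unique-concat⁻ xss rest-unique

module _ {n : ℕ} (w : Fin n → Fin n → ℚ) where

  open +-*-Solver

  sumℚ-combine-≤ : ∀ {A : Set} (α β γ : ℚ) (f g h : A → ℚ) xs →
    All (λ x → α * f x + β * g x ≤ γ * h x) xs →
    α * sumℚ w (map f xs) + β * sumℚ w (map g xs) ≤ γ * sumℚ w (map h xs)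
  sumℚ-combine-≤ α β γ f g h [] [] =
    ≤-reflexive (trans (cong₂ _+_ (*-zeroʳ α) (*-zeroʳ β)) (sym (*-zeroʳ γ)))
  sumℚ-combine-≤ α β γ f g h (x ∷ xs) (hx ∷ hxs) = subst₂ _≤_
    (solve 6 (λ α β a b s t → (α :* a :+ β :* b) :+ (α :* s :+ β :* t)
                            := α :* (a :+ s) :+ β :* (b :+ t))
       refl α β (f x) (g x) (sumℚ w (map f xs)) (sumℚ w (map g xs)))
    (sym (*-distribˡ-+ γ (h x) (sumℚ w (map h xs))))
    (+-mono-≤ hx (sumℚ-combine-≤ α β γ f g h xs hxs))

  initSpokes : Fin n → List (Fin n) → Fin n → ℚ
  initSpokes x []      z = 0ℚ
  initSpokes x (y ∷ r) z = w x z + initSpokes y r z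

  spokes : List (Fin n) → Fin n → ℚ
  spokes []      a = 0ℚ
  spokes (y ∷ r) a = w y a + spokes r a

  lastOf-++ : ∀ x xs y ys → lastOf w x (xs ++ y ∷ ys) ≡ lastOf w y ys
  lastOf-++ x []        y ys = refl
  lastOf-++ x (x′ ∷ xs) y ys = lastOf-++ x′ xs y ys

  lastOf-∈ : ∀ x xs → lastOf w x xs ∈ x ∷ xs
  lastOf-∈ x []       = here refl
  lastOf-∈ x (y ∷ xs) = there (lastOf-∈ y xs)

  pathW-++ : ∀ x xs y ys →
    pathW w (x ∷ xs ++ y ∷ ys) ≡ pathW w (x ∷ xs) + w (lastOf w x xs) y + pathW w (y ∷ ys)
  pathW-++ x []        y ys = cong (_+ pathW w (y ∷ ys)) (sym (+-identityˡ (w x y)))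
  pathW-++ x (x′ ∷ xs) y ys =
    trans (cong (w x x′ +_) (pathW-++ x′ xs y ys))
          (solve 4 (λ a b c d → a :+ (b :+ c :+ d) := a :+ b :+ c :+ d)
                 refl (w x x′) (pathW w (x′ ∷ xs)) (w (lastOf w x′ xs) y) (pathW w (y ∷ ys)))

  reverseAcc-head : ∀ acc y v → ∃ λ cs → reverseAcc acc (y ∷ v) ≡ lastOf w y v ∷ cs
  reverseAcc-head acc y []       = acc , refl
  reverseAcc-head acc y (y′ ∷ v) = reverseAcc-head (y ∷ acc) y′ v

  lastOf-reverseAcc : ∀ d c cs v → lastOf w d (reverseAcc (c ∷ cs) v) ≡ lastOf w c cs
  lastOf-reverseAcc d c cs []      = refl
  lastOf-reverseAcc d c cs (x ∷ v) = lastOf-reverseAcc d x (c ∷ cs) v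

  lastOf-reverse : ∀ d y v → lastOf w d (reverse (y ∷ v)) ≡ y
  lastOf-reverse d y v = lastOf-reverseAcc d y [] v

  pathW-reverseAcc : ∀ c cs y v →
    pathW w (reverseAcc (c ∷ cs) (y ∷ v)) ≡ pathW (flip w) (y ∷ v) + w y c + pathW w (c ∷ cs)
  pathW-reverseAcc c cs y []       = cong (_+ pathW w (c ∷ cs)) (sym (+-identityˡ (w y c)))
  pathW-reverseAcc c cs y (y′ ∷ v) =
    trans (pathW-reverseAcc y (c ∷ cs) y′ v)
          (solve 4 (λ a b c d → a :+ b :+ (c :+ d) := b :+ a :+ c :+ d)
                 refl (pathW (flip w) (y′ ∷ v)) (w y′ y) (w y c) (pathW w (c ∷ cs)))

  pathW-reverse : ∀ y v → pathW w (reverse (y ∷ v)) ≡ pathW (flip w) (y ∷ v)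
  pathW-reverse y []       = refl
  pathW-reverse y (y′ ∷ v) =
    trans (pathW-reverseAcc y [] y′ v)
          (trans (+-identityʳ _) (+-comm (pathW (flip w) (y′ ∷ v)) (w y′ y)))

  Σ<-consecutive : ∀ d a r →
    Σ< (length r) (λ i → w (lastOf w a (take i r)) (headOr d (drop i r))) ≡ pathW w (a ∷ r)
  Σ<-consecutive d a []      = refl
  Σ<-consecutive d a (b ∷ r) = cong (w a b +_) (Σ<-consecutive d b r)

  Σ<-initSpokes : ∀ z a r → Σ< (length r) (λ i → w (lastOf w a (take i r)) z) ≡ initSpokes a r z
  Σ<-initSpokes z a []      = refl
  Σ<-initSpokes z a (b ∷ r) = cong (w a z +_) (Σ<-initSpokes z b r)

  Σ<-spokes : ∀ d a r → Σ< (length r) (λ i → w (headOr d (drop i r)) a) ≡ spokes r a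
  Σ<-spokes d a []      = refl
  Σ<-spokes d a (b ∷ r) = cong (w b a +_) (Σ<-spokes d a r)

  module _ (metric : IsMetric w) where

    open IsMetric metric

    pathW-flip : ∀ xs → Unique xs → pathW (flip w) xs ≡ pathW w xs
    pathW-flip []            _                    = refl
    pathW-flip (x ∷ [])      _                    = refl
    pathW-flip (x ∷ y ∷ xs) ((x≢y ∷ _) ∷ unique) =
      cong₂ _+_ (symmetric y x (≢-sym x≢y)) (pathW-flip (y ∷ xs) unique)

    edge≤spokes : ∀ x y z → x ≢ y → x ≢ z → y ≢ z → w x y ≤ w x z + w y z
    edge≤spokes x y z x≢y x≢z y≢z =
      subst (λ q → w x y ≤ w x z + q) (symmetric z y (≢-sym y≢z))
            (triangle x z y x≢z (≢-sym y≢z) x≢y)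

    cycleW-split : ∀ a t y v → Unique (y ∷ v) →
      cycleW w (a ∷ t ++ reverse (y ∷ v)) + w (lastOf w a t) y
        ≡ pathW w (a ∷ t ++ y ∷ v) + w (lastOf w a t) (lastOf w a (t ++ y ∷ v)) + w y a
    cycleW-split a t y v unique = begin
      cycleW w (a ∷ t ++ reverse (y ∷ v)) + w ℓ y
        ≡⟨ cong (λ c → cycleW w (a ∷ t ++ c) + w ℓ y) reverse≡ ⟩
      (pathW w (a ∷ t ++ m ∷ cs) + w (lastOf w a (t ++ m ∷ cs)) a) + w ℓ y
        ≡⟨ cong₂ (λ p l → (p + w l a) + w ℓ y) (pathW-++ a t m cs) (lastOf-++ a t m cs) ⟩
      ((pathW w (a ∷ t) + w ℓ m + pathW w (m ∷ cs)) + w (lastOf w m cs) a) + w ℓ y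
        ≡⟨ cong₂ (λ p l → ((pathW w (a ∷ t) + w ℓ m + p) + w l a) + w ℓ y)
                 reversed-pathW reversed-last ⟩
      ((pathW w (a ∷ t) + w ℓ m + pathW w (y ∷ v)) + w y a) + w ℓ y
        ≡⟨ solve 5 (λ p e q f g → ((p :+ e :+ q) :+ f) :+ g := (p :+ g :+ q) :+ e :+ f)
                 refl (pathW w (a ∷ t)) (w ℓ m) (pathW w (y ∷ v)) (w y a) (w ℓ y) ⟩
      (pathW w (a ∷ t) + w ℓ y + pathW w (y ∷ v)) + w ℓ m + w y a
        ≡⟨ cong₂ (λ p l → p + w ℓ l + w y a) (sym (pathW-++ a t y v)) (sym (lastOf-++ a t y v)) ⟩
      pathW w (a ∷ t ++ y ∷ v) + w ℓ (lastOf w a (t ++ y ∷ v)) + w y a ∎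
      where
      open ≡-Reasoning
      ℓ = lastOf w a t
      m = lastOf w y v
      cs = proj₁ (reverseAcc-head [] y v)
      reverse≡ : reverse (y ∷ v) ≡ m ∷ cs
      reverse≡ = proj₂ (reverseAcc-head [] y v)
      reversed-pathW : pathW w (m ∷ cs) ≡ pathW w (y ∷ v)
      reversed-pathW = trans (cong (pathW w) (sym reverse≡))
                             (trans (pathW-reverse y v) (pathW-flip (y ∷ v) unique))
      reversed-last : lastOf w m cs ≡ y
      reversed-last = trans (cong (lastOf w a) (sym reverse≡)) (lastOf-reverse a y v)

    cycleOf-identity : ∀ a r i → i <ℕ length r → Unique (a ∷ r) →
      cycleW w (a ∷ take i r ++ reverse (drop i r)) + w (lastOf w a (take i r)) (headOr a (drop i r))
        ≡ pathW w (a ∷ r) + w (lastOf w a (take i r)) (lastOf w a r) + w (headOr a (drop i r)) a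
    cycleOf-identity a r i i<|r| (_ ∷ r-unique)
      with drop i r | take++drop≡id i r | length-drop i r | drop⁺ i r-unique
    ... | []    | _     | 0≡|r|∸i | _ = ⊥-elim (<-irrefl 0≡|r|∸i (m<n⇒0<n∸m i<|r|))
    ... | y ∷ v | split | _       | yv-unique =
      subst (λ r′ → cycleW w (a ∷ take i r ++ reverse (y ∷ v)) + w ℓ y
                      ≡ pathW w (a ∷ r′) + w ℓ (lastOf w a r′) + w y a)
            split (cycleW-split a (take i r) y v yv-unique)
      where ℓ = lastOf w a (take i r)

    cycles-sum+pathW : ∀ a r → Unique (a ∷ r) →
      Σ< (length r) (λ i → cycleW w (cycleOf (a ∷ r) (suc i))) + pathW w (a ∷ r)
        ≡ ℕ→ℚ (length r) * pathW w (a ∷ r) + initSpokes a r (lastOf w a r) + spokes r a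
    cycles-sum+pathW a r unique = begin
      Σ< K C + P                           ≡⟨ cong (Σ< K C +_) (sym (Σ<-consecutive a a r)) ⟩
      Σ< K C + Σ< K e                      ≡⟨ sym (Σ<-+ K C e) ⟩
      Σ< K (λ i → C i + e i)               ≡⟨ Σ<-cong K (λ i i<K → cycleOf-identity a r i i<K unique) ⟩
      Σ< K (λ i → P + f i + g i)           ≡⟨ Σ<-+ K (λ i → P + f i) g ⟩
      Σ< K (λ i → P + f i) + Σ< K g        ≡⟨ cong (_+ Σ< K g) (Σ<-+ K (λ _ → P) f) ⟩
      Σ< K (λ _ → P) + Σ< K f + Σ< K g
        ≡⟨ cong₂ _+_ (cong₂ _+_ (Σ<-const K P) (Σ<-initSpokes (lastOf w a r) a r)) (Σ<-spokes a a r) ⟩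
      ℕ→ℚ K * P + initSpokes a r (lastOf w a r) + spokes r a ∎
      where
      open ≡-Reasoning
      K = length r
      P = pathW w (a ∷ r)
      C e f g : ℕ → ℚ
      C i = cycleW w (cycleOf (a ∷ r) (suc i))
      e i = w (lastOf w a (take i r)) (headOr a (drop i r))
      f i = w (lastOf w a (take i r)) (lastOf w a r)
      g i = w (headOr a (drop i r)) a

    cycles-sum : ∀ a b r → Unique (a ∷ b ∷ r) →
      Σ< (suc (length r)) (λ i → cycleW w (cycleOf (a ∷ b ∷ r) (suc i)))
        ≡ ℕ→ℚ (length r) * pathW w (a ∷ b ∷ r) + (initSpokes a (b ∷ r) (lastOf w b r) + spokes (b ∷ r) a)
    cycles-sum a b r unique = ∙-cancelʳ P _ _ (trans (cycles-sum+pathW a (b ∷ r) unique) regroup)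
      where
      P = pathW w (a ∷ b ∷ r)
      F = initSpokes a (b ∷ r) (lastOf w b r)
      G = spokes (b ∷ r) a
      regroup : ℕ→ℚ (suc (length r)) * P + F + G ≡ (ℕ→ℚ (length r) * P + (F + G)) + P
      regroup = trans (cong (λ q → q * P + F + G) (ℕ→ℚ-suc (length r)))
        (solve 4 (λ k p f g → (con 1ℚ :+ k) :* p :+ f :+ g := (k :* p :+ (f :+ g)) :+ p)
               refl (ℕ→ℚ (length r)) P F G)

    tildeW≤spokes : ∀ a r → 2 ∣ length r → All (a ≢_) r → Unique r → tildeW w r ≤ spokes r a
    tildeW≤spokes a []            _    _ _ = ≤-refl
    tildeW≤spokes a (c ∷ [])      2∣1  _ _ = ⊥-elim (2∤1 2∣1)
    tildeW≤spokes a (c ∷ d ∷ r) even (a≢c ∷ a≢d ∷ a∉r) ((c≢d ∷ _) ∷ _ ∷ r-unique) =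
      ≤-trans (+-mono-≤ (edge≤spokes c d a c≢d (≢-sym a≢c) (≢-sym a≢d))
                        (tildeW≤spokes a r (2∣2+n⇒2∣n even) a∉r r-unique))
              (≤-reflexive (+-assoc (w c a) (w d a) (spokes r a)))

    tildeW≤initSpokes : ∀ c d r → 2 ∣ length r → Unique (c ∷ d ∷ r) →
      tildeW w (c ∷ d ∷ r) ≤ initSpokes c (d ∷ r) (lastOf w d r)
    tildeW≤initSpokes c d []            _   _ = ≤-refl
    tildeW≤initSpokes c d (e ∷ [])      2∣1 _ = ⊥-elim (2∤1 2∣1)
    tildeW≤initSpokes c d (e ∷ f ∷ r) even ((c≢d ∷ c∉) ∷ d∉ ∷ unique) =
      ≤-trans (+-mono-≤ (edge≤spokes c d z c≢d (All.lookup c∉ z∈) (All.lookup d∉ z∈))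
                        (tildeW≤initSpokes e f r (2∣2+n⇒2∣n even) unique))
              (≤-reflexive (+-assoc (w c z) (w d z) (initSpokes e (f ∷ r) z)))
      where
      z = lastOf w f r
      z∈ : z ∈ e ∷ f ∷ r
      z∈ = there (lastOf-∈ f r)

    2*tildeW≤spokeSums : ∀ a b r → 2 ∣ length r → Unique (a ∷ b ∷ r) →
      ℕ→ℚ 2 * tildeW w (a ∷ b ∷ r) ≤ initSpokes a (b ∷ r) (lastOf w b r) + spokes (b ∷ r) a
    2*tildeW≤spokeSums a b r even unique@((a≢b ∷ a∉r) ∷ _ ∷ r-unique) =
      ≤-trans (≤-reflexive (2*q≡q+q (tildeW w (a ∷ b ∷ r))))
        (+-mono-≤ (tildeW≤initSpokes a b r even unique)
                  (+-mono-≤ (≤-reflexive (symmetric a b a≢b)) (tildeW≤spokes a r even a∉r r-unique)))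

    path-cycle-bound : ∀ a b r → 2 ∣ length r → Unique (a ∷ b ∷ r) → ∀ j →
      (∀ j′ → 1 ≤ℕ j′ → j′ ≤ℕ suc (length r) →
        cycleW w (cycleOf (a ∷ b ∷ r) j′) ≤ cycleW w (cycleOf (a ∷ b ∷ r) j)) →
      ℕ→ℚ (length r) * pathW w (a ∷ b ∷ r) + ℕ→ℚ 2 * tildeW w (a ∷ b ∷ r)
        ≤ ℕ→ℚ (suc (length r)) * cycleW w (cycleOf (a ∷ b ∷ r) j)
    path-cycle-bound a b r even unique j maximal = begin
      ℕ→ℚ (length r) * P + ℕ→ℚ 2 * tildeW w p
        ≤⟨ +-monoʳ-≤ (ℕ→ℚ (length r) * P) (2*tildeW≤spokeSums a b r even unique) ⟩
      ℕ→ℚ (length r) * P + (initSpokes a (b ∷ r) (lastOf w b r) + spokes (b ∷ r) a)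
        ≡⟨ sym (cycles-sum a b r unique) ⟩
      Σ< (suc (length r)) (λ i → cycleW w (cycleOf p (suc i)))
        ≤⟨ Σ<-mono (suc (length r)) (λ i i<k-1 → maximal (suc i) (s≤s z≤n) i<k-1) ⟩
      Σ< (suc (length r)) (λ _ → cycleW w (cycleOf p j))
        ≡⟨ Σ<-const (suc (length r)) _ ⟩
      ℕ→ℚ (suc (length r)) * cycleW w (cycleOf p j) ∎
      where
      open ≤-Reasoning
      p = a ∷ b ∷ r
      P = pathW w p

k-path-bound : ∀ {n} {w : Fin n → Fin n → ℚ} → IsMetric w →
  ∀ k p → 4 ≤ℕ k → 2 ∣ k → length p ≡ k → Unique p → ∀ j →
  (∀ j′ → 1 ≤ℕ j′ → j′ ≤ℕ k ∸ 1 → cycleW w (cycleOf p j′) ≤ cycleW w (cycleOf p j)) →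
  ℕ→ℚ (k ∸ 2) * pathW w p + ℕ→ℚ 2 * tildeW w p ≤ ℕ→ℚ (k ∸ 1) * cycleW w (cycleOf p j)
k-path-bound metric _ []          ()                  _    refl
k-path-bound metric _ (a ∷ [])    (s≤s ())            _    refl
k-path-bound {w = w} metric _ (a ∷ b ∷ r) _ even refl unique =
  path-cycle-bound w metric a b r (2∣2+n⇒2∣n even) unique

mainTheorem14 : (n k : ℕ) → 4 ≤ℕ k → 2 ∣ k → k ∣ n →
    (w : Fin n → Fin n → ℚ) → IsMetric w →
    (P : List (List (Fin n))) → IsKPathPacking k P →
    (J : List (Fin n) → ℕ) →
    All (λ p → (1 ≤ℕ J p) × (J p ≤ℕ k ∸ 1) ×
               (∀ j → 1 ≤ℕ j → j ≤ℕ k ∸ 1 →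
                  cycleW w (cycleOf p j) ≤ cycleW w (cycleOf p (J p)))) P →
    (ℕ→ℚ (k ∸ 2) * pathsW w P) + (ℕ→ℚ 2 * tildeWs w P)
      ≤ ℕ→ℚ (k ∸ 1) * sumℚ w (map (λ p → cycleW w (cycleOf p (J p))) P)
mainTheorem14 n k 4≤k 2∣k _ w metric P (lengths , P↭allFin) J choice =
  sumℚ-combine-≤ w (ℕ→ℚ (k ∸ 2)) (ℕ→ℚ 2) (ℕ→ℚ (k ∸ 1))
    (pathW w) (tildeW w) (λ p → cycleW w (cycleOf p (J p))) P
    (All.zipWith (λ {p} ((length≡k , unique) , (_ , _ , maximal)) →
                    k-path-bound metric k p 4≤k 2∣k length≡k unique (J p) maximal)
                 (All.zip (lengths , Unique-concat⁻ P concat-unique) , choice))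
  where
  concat-unique : Unique (concat P)
  concat-unique = Permutation.Unique-resp-↭ (setoid (Fin n)) (↭⇒↭ₛ (↭-sym P↭allFin)) (allFin⁺ n)
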